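{- Let $q$ be a prime power and all exponents below lie in $\{1,\dots,q-1\}$ (exponents being taken modulo $q-1$ into this range). Then: (i) If $\gcd(m,q-1)=1$, then $D(q;m,n)\cong D(q;1,n')$ for some integer $n'$ with $mn'\equiv n\pmod{q-1}$. (ii) If $mn\equiv 1\pmod{q-1}$, then $D(q;m,1)\cong D(q;1,n)$, and $D(q;m,n)\cong D(q;1,n^2)\cong D(q;m^2,1)$. (iii) If $m+n\equiv 0\pmod{q-1}$, then $D(q;m,n)\cong D(q;n,m)$. (iv) If $D(q;m_1,n_1)\cong D(q;m_2,n_2)$ and $m_1=n_1$, then $m_2=n_2$ and $\gcd(m_1,q-1)=\gcd(m_2,q-1)$. (v) If $\gcd(m,q-1)=\gcd(n,q-1)$, then $D(q;m,m)\cong D(q;n,n)$.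
   Context: $\mathbb{F}_q$ is the field with $q$ elements. For integers $1\le m,n\le q-1$, the monomial digraph $D(q;m,n)$ has vertex set $\mathbb{F}_q^2$, and $((x_1,x_2),(y_1,y_2))$ is an arc iff $x_2+y_2=x_1^m y_1^n$. Since $a^q=a$ for $a\in\mathbb{F}_q$, exponents are understood modulo $q-1$ with representatives in $\{1,\dots,q-1\}$. $\cong$ denotes digraph isomorphism. -}

module Defs where

open import Level using (0ℓ)
open import Data.Nat as ℕ using (ℕ; zero; suc; _≤_; _∸_)
open import Data.Fin using (Fin)
open import Data.Product using (_×_; _,_; Σ; ∃; ∃-syntax)
open import Relation.Nullary using (¬_)
open import Relation.Binary.PropositionalEquality using (_≡_)
open import Algebra.Structures using (IsCommutativeRing)
open import Function.Bundles using (_⤖_; Bijection; _⇔_)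

-- A finite field with exactly q elements (q is then necessarily a prime power).
record FiniteField (q : ℕ) : Set₁ where
  field
    Carrier : Set
    _+_     : Carrier → Carrier → Carrier
    _*_     : Carrier → Carrier → Carrier
    -_      : Carrier → Carrier
    0#      : Carrier
    1#      : Carrier
    isCommutativeRing : IsCommutativeRing _≡_ _+_ _*_ -_ 0# 1#
    0≢1     : ¬ (0# ≡ 1#)
    inverse : ∀ x → ¬ (x ≡ 0#) → ∃[ y ] (x * y ≡ 1#)
    card    : Carrier ⤖ Fin q

  _^_ : Carrier → ℕ → Carrier
  x ^ zero  = 1#
  x ^ suc k = x * (x ^ k)

  Vertex : Set
  Vertex = Carrier × Carrier

  Arc : ℕ → ℕ → Vertex → Vertex → Set
  Arc m n (x₁ , x₂) (y₁ , y₂) = (x₂ + y₂) ≡ ((x₁ ^ m) * (y₁ ^ n))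

  _≅D_ : ℕ × ℕ → ℕ × ℕ → Set
  (m₁ , n₁) ≅D (m₂ , n₂) =
    Σ (Vertex ⤖ Vertex) λ φ →
      ∀ u v → Arc m₁ n₁ u v ⇔ Arc m₂ n₂ (Bijection.to φ u) (Bijection.to φ v)

InRange : ℕ → ℕ → Set
InRange q m = 1 ≤ m × m ≤ q ∸ 1

infix 4 _≡_[mod_]
_≡_[mod_] : ℕ → ℕ → ℕ → Set
a ≡ b [mod k ] = ∃[ s ] ∃[ t ] (a ℕ.+ s ℕ.* k ≡ b ℕ.+ t ℕ.* k)

-- Raising the first coordinate to a power k that is invertible modulo q − 1 is a bijection
-- of F_q² (as x^(q−1) = 1 for x ≠ 0), and it carries D(a, b) onto D(a′, b′) whenever
-- a ≡ k a′ and b ≡ k b′. Parts (i), (ii), (iii) and (v) follow by choosing k to be an inverse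
-- of m, the exponent m itself, −1, and a unit with m ≡ k n respectively; such a unit exists when
-- gcd(m, q − 1) = gcd(n, q − 1). For (iv), the arcs of D(m, m) are symmetric, so an isomorphic
-- D(m₂, n₂) has x^m₂ = x^n₂ for all x, forcing m₂ = n₂. Moreover, the vertices of D(m, n) with the
-- same out-neighbourhood as (1, 0) correspond to the m-th roots of unity, of which there are
-- gcd(m, q − 1), and no such class is larger; hence this gcd is an isomorphism invariant.
module Submission where

open import Defs
open import Data.Nat using (ℕ; _*_; _+_; _∸_)
open import Data.Nat.GCD using (gcd)
open import Data.Product using (_×_; _,_; ∃-syntax)
open import Relation.Binary.PropositionalEquality using (_≡_)

open import Level using (0ℓ)
open import Data.Nat as ℕ
  using (zero; suc; _≤_; _<_; z≤n; s≤s; NonZero; NonTrivial; ≢-nonZero; ≢-nonZero⁻¹; >-nonZero⁻¹)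
import Data.Nat.Properties as ℕ
open import Data.Nat.DivMod
open import Data.Nat.Divisibility
open import Data.Nat.Coprimality using (Coprime; coprime-divisor; gcd≡1⇒coprime; coprime⇒gcd≡1) renaming (sym to ⊥-sym)
open import Data.Nat.GCD using (gcd-GCD; module Bézout; gcd[m,n]∣m; gcd[m,n]∣n; gcd[m,n]≡0⇒m≡0; gcd[m,n]≢0; gcd-greatest)
open import Data.Nat.Induction using (<-wellFounded)
open import Data.Nat.Tactic.RingSolver using (solve-∀)
open import Induction.WellFounded using (Acc; acc)
open import Data.Fin as Fin using (Fin)
import Data.Fin.Properties as Fin
open import Data.Fin.Permutation as Perm using (Permutation; _⟨$⟩ʳ_)
open import Data.List using (List; []; _∷_; length; map; filter; tabulate)
open import Data.List.Properties using (length-map; length-tabulate)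
open import Data.List.Relation.Unary.All as All using (All; []; _∷_)
import Data.List.Relation.Unary.All.Properties as All
open import Data.List.Relation.Unary.AllPairs using ([]; _∷_)
open import Data.List.Relation.Unary.Unique.Propositional using (Unique)
import Data.List.Relation.Unary.Unique.Propositional.Properties as Unique
open import Data.Product using (proj₁; proj₂)
open import Data.Sum using (inj₂)
open import Relation.Nullary using (¬_; Dec; yes; no; contradiction)
open import Relation.Nullary.Decidable using (map′; ¬?)
open import Relation.Binary.Definitions using (DecidableEquality; tri<; tri≈; tri>)
open import Relation.Binary.PropositionalEquality using (_≢_; refl; sym; trans; cong; cong₂; subst; subst₂; module ≡-Reasoning)
import Relation.Binary.Reasoning.Setoid as SetoidReasoning
open import Algebra.Bundles using (CommutativeRing)
open import Algebra.Structures using (IsCommutativeRing)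
import Algebra.Properties.CommutativeMonoid.Sum
import Algebra.Properties.CommutativeSemiring.Exp as Exp
open import Algebra.Properties.CommutativeSemigroup ℕ.+-commutativeSemigroup using (xy∙z≈xz∙y)
import Algebra.Properties.Group as GroupProperties
import Algebra.Solver.Ring.NaturalCoefficients.Default as NaturalSolver
open import Function using (_∘_; it)
open import Function.Bundles using (_↔_; _⇔_; Inverse; Bijection; Equivalence; mk↔ₛ′; mk⇔)
open import Function.Properties.Bijection using (⤖⇒↔)
open import Function.Properties.Inverse using (↔-sym; ↔-trans; ↔⇒⤖)
open import Function.Properties.Equivalence using (⇔-setoid)

coprime-*ʳ : ∀ {k c e} → Coprime k c → Coprime k e → Coprime k (c * e)
coprime-*ʳ {k} {c} k⊥c k⊥e {i} (i∣k , i∣ce) = k⊥e (i∣k , coprime-divisor i⊥c i∣ce)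
  where
  i⊥c : Coprime i c
  i⊥c (j∣i , j∣c) = k⊥c (∣-trans j∣i i∣k , j∣c)

coprime-^ʳ : ∀ {k a} → Coprime k a → ∀ r → Coprime k (a ℕ.^ r)
coprime-^ʳ k⊥a zero (_ , i∣1) = ∣1⇒≡1 i∣1
coprime-^ʳ k⊥a (suc r) = coprime-*ʳ k⊥a (coprime-^ʳ k⊥a r)

coprime-∣ʳ : ∀ {k a e} → Coprime k a → e ∣ a → Coprime k e
coprime-∣ʳ k⊥a e∣a (i∣k , i∣e) = k⊥a (i∣k , ∣-trans i∣e e∣a)

nonTrivial-≢0-≢1 : ∀ {g} → g ≢ 0 → g ≢ 1 → NonTrivial g
nonTrivial-≢0-≢1 {0} g≢0 _ = contradiction refl g≢0
nonTrivial-≢0-≢1 {1} _ g≢1 = contradiction refl g≢1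
nonTrivial-≢0-≢1 {suc (suc _)} _ _ = _

coprime-split : ∀ a N → .{{NonZero N}} →
  ∃[ c ] ∃[ e ] ∃[ r ] (N ≡ c * e × Coprime c a × e ∣ a ℕ.^ r)
coprime-split a N = go N (<-wellFounded N)
  where
  go : ∀ N → Acc _<_ N → .{{NonZero N}} → ∃[ c ] ∃[ e ] ∃[ r ] (N ≡ c * e × Coprime c a × e ∣ a ℕ.^ r)
  go N (acc rec) with gcd N a ℕ.≟ 1 | gcd[m,n]∣m N a
  ... | yes g≡1 | _ = N , 1 , 0 , sym (ℕ.*-identityʳ N) , gcd≡1⇒coprime g≡1 , ∣-refl
  ... | no g≢1 | g∣N@(divides N′ N≡N′g) with go N′ (rec (quotient-< g∣N {{g-nonTrivial}})) {{quotient≢0 g∣N}}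
    where
    g-nonTrivial : NonTrivial (gcd N a)
    g-nonTrivial = nonTrivial-≢0-≢1 (≢-nonZero⁻¹ N ∘ gcd[m,n]≡0⇒m≡0) g≢1
  ... | c , e , r , N′≡ce , c⊥a , e∣aʳ =
    c , e * gcd N a , suc r , trans N≡N′g (trans (cong (_* gcd N a) N′≡ce) (ℕ.*-assoc c e _)) , c⊥a ,
    subst (e * gcd N a ∣_) (ℕ.*-comm (a ℕ.^ r) a) (*-pres-∣ e∣aʳ (gcd[m,n]∣n N a))

coprime-lift : ∀ {a M} N → .{{NonZero N}} → Coprime a M → ∃[ c ] (1 ≤ c × Coprime (a + M * c) N)
coprime-lift {a} {M} N a⊥M with coprime-split a N
... | c , e , r , N≡ce , c⊥a , e∣aʳ =
  c , 1≤c , subst (Coprime k) (sym N≡ce) (coprime-*ʳ k⊥c (coprime-∣ʳ (coprime-^ʳ k⊥a r) e∣aʳ))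
  where
  k = a + M * c
  1≤c : 1 ≤ c
  1≤c = >-nonZero⁻¹ c {{ℕ.m*n≢0⇒m≢0 c {{subst NonZero N≡ce it}}}}
  k⊥c : Coprime k c
  k⊥c {i} (i∣k , i∣c) = c⊥a (i∣c , ∣m+n∣m⇒∣n (subst (i ∣_) (ℕ.+-comm a (M * c)) i∣k) (∣n⇒∣m*n M i∣c))
  k⊥a : Coprime k a
  k⊥a {i} (i∣k , i∣a) = c⊥a (coprime-divisor i⊥M (∣m+n∣m⇒∣n i∣k i∣a) , i∣a)
    where
    i⊥M : Coprime i M
    i⊥M (j∣i , j∣M) = a⊥M (∣-trans j∣i i∣a , j∣M)

module _ {a p} {A : Set a} {P : A → Set p} (P? : ∀ x → Dec (P x)) where

  length-filter-∁ : ∀ xs → length (filter P? xs) + length (filter (¬? ∘ P?) xs) ≡ length xs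
  length-filter-∁ [] = refl
  length-filter-∁ (x ∷ xs) with P? x
  ... | yes _ = cong suc (length-filter-∁ xs)
  ... | no _ = trans (ℕ.+-suc _ _) (cong suc (length-filter-∁ xs))

module _ {a b p} {A : Set a} {B : Set b} {P : A → Set p} {f : A → B} where

  Unique-map⁺ : (∀ {x y} → P x → P y → f x ≡ f y → x ≡ y) → ∀ {xs} → All P xs → Unique xs → Unique (map f xs)
  Unique-map⁺ f-inj [] [] = []
  Unique-map⁺ f-inj (px ∷ pxs) (x∉xs ∷ xs-unique) =
    All.map⁺ (All.zipWith (λ (py , x≢y) fx≡fy → x≢y (f-inj px py fx≡fy)) (pxs , x∉xs)) ∷ Unique-map⁺ f-inj pxs xs-unique

module Residues (n : ℕ) where
  open ≡-Reasoning

  private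
    N : ℕ
    N = suc n

  ≡[mod]⇒%≡ : ∀ {a b} → a ≡ b [mod N ] → a % N ≡ b % N
  ≡[mod]⇒%≡ {a} {b} (s , t , eq) = begin
    a % N             ≡⟨ [m+kn]%n≡m%n a s N ⟨
    (a + s * N) % N   ≡⟨ cong (_% N) eq ⟩
    (b + t * N) % N   ≡⟨ [m+kn]%n≡m%n b t N ⟩
    b % N             ∎

  %≡⇒≡[mod] : ∀ {a b} → a % N ≡ b % N → a ≡ b [mod N ]
  %≡⇒≡[mod] {a} {b} eq = b / N , a / N , (begin
    a + b / N * N                       ≡⟨ cong (_+ b / N * N) (m≡m%n+[m/n]*n a N) ⟩
    a % N + a / N * N + b / N * N       ≡⟨ cong (λ r → r + a / N * N + b / N * N) eq ⟩
    b % N + a / N * N + b / N * N       ≡⟨ xy∙z≈xz∙y (b % N) _ _ ⟩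
    b % N + b / N * N + a / N * N       ≡⟨ cong (_+ a / N * N) (m≡m%n+[m/n]*n b N) ⟨
    b + a / N * N                       ∎)

  %-cong-*ˡ : ∀ c {a b} → a % N ≡ b % N → (c * a) % N ≡ (c * b) % N
  %-cong-*ˡ c {a} {b} eq = begin
    (c * a) % N               ≡⟨ %-distribˡ-* c a N ⟩
    (c % N * (a % N)) % N     ≡⟨ cong (λ r → (c % N * r) % N) eq ⟩
    (c % N * (b % N)) % N     ≡⟨ %-distribˡ-* c b N ⟨
    (c * b) % N               ∎

  ∃-positive-representative : ∀ a → ∃[ r ] (InRange (suc N) r × r % N ≡ a % N)
  ∃-positive-representative a with a % N | m%n<n a N
  ... | zero  | _   = N , (s≤s z≤n , ℕ.≤-refl) , n%n≡0 N
  ... | suc r | r<N = suc r , (s≤s z≤n , ℕ.<⇒≤ r<N) , m<n⇒m%n≡m r<N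

  bézout-% : ∀ a → ∃[ u ] ((u * a) % N ≡ gcd a N % N)
  bézout-% a with Bézout.identity (gcd-GCD a N)
  ... | Bézout.+- x y eq = x , (begin
    (x * a) % N               ≡⟨ cong (_% N) eq ⟨
    (gcd a N + y * N) % N     ≡⟨ [m+kn]%n≡m%n (gcd a N) y N ⟩
    gcd a N % N               ∎)
  ... | Bézout.-+ x y eq = n * x , (begin
    (n * x * a) % N                     ≡⟨ [m+kn]%n≡m%n (n * x * a) y N ⟨
    (n * x * a + y * N) % N             ≡⟨ cong (λ z → (n * x * a + z) % N) eq ⟨
    (n * x * a + (gcd a N + x * a)) % N ≡⟨ cong (_% N) (regroup n x a (gcd a N)) ⟩
    (gcd a N + x * a * N) % N           ≡⟨ [m+kn]%n≡m%n (gcd a N) (x * a) N ⟩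
    gcd a N % N                         ∎)
    where
    regroup : ∀ n x a d → n * x * a + (d + x * a) ≡ d + x * a * suc n
    regroup = solve-∀

  ∃-inverse : ∀ a → gcd a N ≡ 1 → ∃[ a′ ] (1 ≤ a′ × (a * a′) % N ≡ 1 % N)
  ∃-inverse a a⊥N with bézout-% a
  ... | u , ua≡gcd with ∃-positive-representative u
  ... | a′ , (1≤a′ , _) , a′≡u = a′ , 1≤a′ , (begin
    (a * a′) % N    ≡⟨ %-cong-*ˡ a a′≡u ⟩
    (a * u) % N     ≡⟨ cong (_% N) (ℕ.*-comm a u) ⟩
    (u * a) % N     ≡⟨ ua≡gcd ⟩
    gcd a N % N     ≡⟨ cong (_% N) a⊥N ⟩
    1 % N           ∎)

  -- 2N − 1 represents −1 and, unlike N − 1, is a positive exponent even when N = 1.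
  minus-one : ℕ
  minus-one = N + n

  minus-one² : (minus-one * minus-one) % N ≡ 1 % N
  minus-one² = trans (cong (_% N) (square n)) ([m+kn]%n≡m%n 1 (4 * n) N)
    where
    square : ∀ n → (suc n + n) * (suc n + n) ≡ 1 + 4 * n * suc n
    square = solve-∀

  %≡0⇒≡minus-one* : ∀ a b → (a + b) % N ≡ 0 % N → a % N ≡ (minus-one * b) % N
  %≡0⇒≡minus-one* a b a+b≡0 = begin
    a % N                                   ≡⟨ [m+kn]%n≡m%n a (2 * b) N ⟨
    (a + 2 * b * N) % N                     ≡⟨ cong (_% N) (regroup a b n) ⟩
    (a + b + minus-one * b) % N             ≡⟨ %-distribˡ-+ (a + b) (minus-one * b) N ⟩
    ((a + b) % N + (minus-one * b) % N) % N ≡⟨ cong (λ r → (r + (minus-one * b) % N) % N) a+b≡0 ⟩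
    (minus-one * b) % N % N                 ≡⟨ m%n%n≡m%n (minus-one * b) N ⟩
    (minus-one * b) % N                     ∎
    where
    regroup : ∀ a b n → a + 2 * b * suc n ≡ a + b + (suc n + n) * b
    regroup = solve-∀

  cancel-gcd : ∀ {i} m → i * gcd m N ∣ gcd m N → i ≡ 1
  cancel-gcd {i} m id∣d = ∣1⇒≡1 (*-cancelʳ-∣ {i} {1} (gcd m N) {{gcd≢0}}
    (subst (i * gcd m N ∣_) (sym (ℕ.*-identityˡ (gcd m N))) id∣d))
    where
    gcd≢0 : NonZero (gcd m N)
    gcd≢0 = ≢-nonZero (gcd[m,n]≢0 m N (inj₂ λ ()))

  bézout-coefficient-coprime : ∀ {u b M} → N ≡ M * gcd b N → (u * b) % N ≡ gcd b N % N → Coprime u M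
  bézout-coefficient-coprime {u} {b} {M} N≡Md ub≡d {i} (i∣u , i∣M) = i≡1 (%≡⇒≡[mod] {u * b} {d} ub≡d)
    where
    d = gcd b N
    id∣N : i * d ∣ N
    id∣N = subst (i * d ∣_) (sym N≡Md) (*-pres-∣ i∣M (∣-refl {d}))
    id∣ub : i * d ∣ u * b
    id∣ub = *-pres-∣ i∣u (gcd[m,n]∣m b N)
    i≡1 : u * b ≡ d [mod N ] → i ≡ 1
    i≡1 (s , t , ub+sN≡d+tN) = cancel-gcd b (∣m+n∣m⇒∣n {i * d} {t * N} {d}
      (subst (i * d ∣_) (trans ub+sN≡d+tN (ℕ.+-comm d (t * N))) (∣m∣n⇒∣m+n id∣ub (∣n⇒∣m*n s {N} id∣N)))
      (∣n⇒∣m*n t {N} id∣N))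

  cofactor-coprime : ∀ {m m₀ M} → m ≡ m₀ * gcd m N → N ≡ M * gcd m N → Coprime m₀ M
  cofactor-coprime {m} {m₀} {M} m≡m₀d N≡Md {i} (i∣m₀ , i∣M) = cancel-gcd m (gcd-greatest
    (subst (i * gcd m N ∣_) (sym m≡m₀d) (*-pres-∣ i∣m₀ (∣-refl {gcd m N})))
    (subst (i * gcd m N ∣_) (sym N≡Md) (*-pres-∣ i∣M (∣-refl {gcd m N}))))

  %-cofactor-invariant : ∀ {M b} a c → N ≡ M * gcd b N → (a + M * c) * b % N ≡ a * b % N
  %-cofactor-invariant {M} {b} a c N≡Md = begin
    (a + M * c) * b % N                ≡⟨ cong (λ x → (a + M * c) * x % N) b≡b₀d ⟩
    (a + M * c) * (b₀ * d) % N         ≡⟨ cong (_% N) (distrib a M c b₀ d) ⟩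
    (a * (b₀ * d) + c * b₀ * (M * d)) % N ≡⟨ cong₂ (λ x y → (a * x + c * b₀ * y) % N) b≡b₀d N≡Md ⟨
    (a * b + c * b₀ * N) % N           ≡⟨ [m+kn]%n≡m%n (a * b) (c * b₀) N ⟩
    a * b % N                          ∎
    where
    d = gcd b N
    b₀ = quotient (gcd[m,n]∣m b N)
    b≡b₀d : b ≡ b₀ * d
    b≡b₀d = m∣n⇒n≡quotient*m (gcd[m,n]∣m b N)
    distrib : ∀ a M c b₀ d → (a + M * c) * (b₀ * d) ≡ a * (b₀ * d) + c * b₀ * (M * d)
    distrib = solve-∀

  ∃-cofactor-unit-multiple : ∀ {M} m b → gcd m N ≡ gcd b N → N ≡ M * gcd b N →
    ∃[ a ] (Coprime a M × m % N ≡ a * b % N)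
  ∃-cofactor-unit-multiple {M} m b gcd≡ N≡Md = m₀ * u , m₀u⊥M , (begin
    m % N              ≡⟨ cong (_% N) m≡m₀d ⟩
    m₀ * d % N         ≡⟨ %-cong-*ˡ m₀ ub≡d ⟨
    m₀ * (u * b) % N   ≡⟨ cong (_% N) (ℕ.*-assoc m₀ u b) ⟨
    m₀ * u * b % N     ∎)
    where
    d = gcd b N
    m₀ = quotient (gcd[m,n]∣m m N)
    m≡m₀d : m ≡ m₀ * d
    m≡m₀d = trans (m∣n⇒n≡quotient*m (gcd[m,n]∣m m N)) (cong (m₀ *_) gcd≡)
    u = proj₁ (bézout-% b)
    ub≡d : u * b % N ≡ d % N
    ub≡d = proj₂ (bézout-% b)
    m₀u⊥M : Coprime (m₀ * u) M
    m₀u⊥M = ⊥-sym (coprime-*ʳ {M} {m₀} {u}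
      (⊥-sym (cofactor-coprime {m} {m₀} {M} (trans m≡m₀d (cong (m₀ *_) (sym gcd≡))) (trans N≡Md (cong (M *_) (sym gcd≡)))))
      (⊥-sym (bézout-coefficient-coprime {u} {b} {M} N≡Md ub≡d)))

  ∃-unit-multiple : ∀ m b → gcd m N ≡ gcd b N → ∃[ k ] (1 ≤ k × gcd k N ≡ 1 × m % N ≡ k * b % N)
  ∃-unit-multiple m b gcd≡ =
    let a , a⊥M , m≡ab = ∃-cofactor-unit-multiple {M} m b gcd≡ N≡Md
        c , 1≤c , a+Mc⊥N = coprime-lift {a} {M} N a⊥M
    in a + M * c , ℕ.≤-trans (ℕ.*-mono-≤ (>-nonZero⁻¹ M) 1≤c) (ℕ.m≤n+m (M * c) a) , coprime⇒gcd≡1 a+Mc⊥N ,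
       trans m≡ab (sym (%-cofactor-invariant {M} {b} a c N≡Md))
    where
    M = quotient (gcd[m,n]∣n b N)
    N≡Md : N ≡ M * gcd b N
    N≡Md = m∣n⇒n≡quotient*m (gcd[m,n]∣n b N)
    instance
      M≢0 : NonZero M
      M≢0 = ℕ.m*n≢0⇒m≢0 M {{subst NonZero N≡Md it}}

module FieldProperties {q : ℕ} (K : FiniteField q) where
  open FiniteField K renaming (_+_ to infixl 6 _⊕_; _*_ to infixl 7 _·_; -_ to ⊝_)
  open IsCommutativeRing isCommutativeRing
    using (+-assoc; +-comm; -‿inverseˡ; +-identityˡ; +-identityʳ; -‿inverseʳ; *-assoc; *-comm; *-identityˡ; *-identityʳ; zeroˡ; zeroʳ)
  open ≡-Reasoning

  ring : CommutativeRing 0ℓ 0ℓ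
  ring = record { isCommutativeRing = isCommutativeRing }

  private
    module ^ = Exp (CommutativeRing.commutativeSemiring ring)
    module + = GroupProperties (CommutativeRing.+-group ring)
    open NaturalSolver (CommutativeRing.commutativeSemiring ring) using (solve; _:=_; _:+_; _:*_; con)

  card↔ : Carrier ↔ Fin q
  card↔ = ⤖⇒↔ card

  open Inverse card↔ public using ()
    renaming (to to index; from to element; strictlyInverseˡ to index-element; strictlyInverseʳ to element-index)

  infix 4 _≟_
  _≟_ : DecidableEquality Carrier
  x ≟ y = map′ (Bijection.injective card) (cong index) (index x Fin.≟ index y)

  ^≡^ : ∀ x k → x ^ k ≡ x ^.^ k
  ^≡^ x zero = refl
  ^≡^ x (suc k) = cong (x ·_) (^≡^ x k)

  ^-+ : ∀ x a b → x ^ (a + b) ≡ x ^ a · x ^ b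
  ^-+ x a b = trans (^≡^ x (a + b)) (trans (^.^-homo-* x a b) (sym (cong₂ _·_ (^≡^ x a) (^≡^ x b))))

  ^-* : ∀ x a b → x ^ (a * b) ≡ (x ^ a) ^ b
  ^-* x a b = trans (^≡^ x (a * b)) (trans (sym (^.^-assocʳ x a b))
    (sym (trans (^≡^ (x ^ a) b) (cong (^._^ b) (^≡^ x a)))))

  1^ : ∀ k → 1# ^ k ≡ 1#
  1^ zero = refl
  1^ (suc k) = trans (*-identityˡ _) (1^ k)

  0^ : ∀ {k} → 1 ≤ k → 0# ^ k ≡ 0#
  0^ {suc k} _ = zeroˡ _

  +-cancelʳ : ∀ {a b} c → a ⊕ c ≡ b ⊕ c → a ≡ b
  +-cancelʳ c = +.∙-cancelʳ c _ _

  x-y≡0⇒x≡y : ∀ {x y} → x ⊕ ⊝ y ≡ 0# → x ≡ y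
  x-y≡0⇒x≡y = +.x∙y⁻¹≈ε⇒x≈y _ _

  1≢0 : 1# ≢ 0#
  1≢0 1≡0 = 0≢1 (sym 1≡0)

  ·-cancelˡ : ∀ {x a b} → x ≢ 0# → x · a ≡ x · b → a ≡ b
  ·-cancelˡ {x} {a} {b} x≢0 xa≡xb with inverse x x≢0
  ... | y , xy≡1 = begin
    a             ≡⟨ *-identityˡ a ⟨
    1# · a        ≡⟨ cong (_· a) (trans (*-comm y x) xy≡1) ⟨
    y · x · a     ≡⟨ *-assoc y x a ⟩
    y · (x · a)   ≡⟨ cong (y ·_) xa≡xb ⟩
    y · (x · b)   ≡⟨ *-assoc y x b ⟨
    y · x · b     ≡⟨ cong (_· b) (trans (*-comm y x) xy≡1) ⟩
    1# · b        ≡⟨ *-identityˡ b ⟩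
    b             ∎

  ·-≢0 : ∀ {x y} → x ≢ 0# → y ≢ 0# → x · y ≢ 0#
  ·-≢0 {x} x≢0 y≢0 xy≡0 = y≢0 (·-cancelˡ x≢0 (trans xy≡0 (sym (zeroʳ x))))

  ^-≢0 : ∀ {x} k → x ≢ 0# → x ^ k ≢ 0#
  ^-≢0 zero x≢0 = 1≢0
  ^-≢0 (suc k) x≢0 = ·-≢0 x≢0 (^-≢0 k x≢0)

  ^≡0⇒≡0 : ∀ {x} k → x ^ k ≡ 0# → x ≡ 0#
  ^≡0⇒≡0 {x} k xᵏ≡0 with x ≟ 0#
  ... | yes x≡0 = x≡0
  ... | no x≢0 = contradiction xᵏ≡0 (^-≢0 k x≢0)

  ^-∣ : ∀ {g a y} → g ∣ a → y ^ g ≡ 1# → y ^ a ≡ 1#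
  ^-∣ {g} {y = y} (divides k a≡kg) yᵍ≡1 =
    trans (cong (y ^_) (trans a≡kg (ℕ.*-comm k g))) (trans (^-* y g k) (trans (cong (_^ k) yᵍ≡1) (1^ k)))

  -- Polynomial functions of degree at most d, in Horner form.
  IsPolynomial : ℕ → (Carrier → Carrier) → Set
  IsPolynomial zero f = ∃[ c ] (∀ x → f x ≡ c)
  IsPolynomial (suc d) f = ∃[ c ] ∃[ g ] (IsPolynomial d g × (∀ x → f x ≡ c ⊕ x · g x))

  isPolynomial-resp-≗ : ∀ d {f g} → (∀ x → g x ≡ f x) → IsPolynomial d f → IsPolynomial d g
  isPolynomial-resp-≗ zero g≗f (c , f≗c) = c , λ x → trans (g≗f x) (f≗c x)
  isPolynomial-resp-≗ (suc d) g≗f (c , h , h-poly , f≗) = c , h , h-poly , λ x → trans (g≗f x) (f≗ x)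

  isPolynomial-const⊕ : ∀ d {f} k → IsPolynomial d f → IsPolynomial d (λ x → k ⊕ f x)
  isPolynomial-const⊕ zero k (c , f≗c) = k ⊕ c , λ x → cong (k ⊕_) (f≗c x)
  isPolynomial-const⊕ (suc d) k (c , g , g-poly , f≗) = k ⊕ c , g , g-poly , λ x → trans (cong (k ⊕_) (f≗ x)) (sym (+-assoc _ _ _))

  isPolynomial-^· : ∀ e d {f} → IsPolynomial d f → IsPolynomial (e + d) (λ x → x ^ e · f x)
  isPolynomial-^· zero d f-poly = isPolynomial-resp-≗ d (λ x → *-identityˡ _) f-poly
  isPolynomial-^· (suc e) d {f} f-poly =
    0# , (λ x → x ^ e · f x) , isPolynomial-^· e d f-poly , λ x → trans (*-assoc _ _ _) (sym (+-identityˡ _))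

  isPolynomial-^ : ∀ d → IsPolynomial d (_^ d)
  isPolynomial-^ d = subst (λ e → IsPolynomial e (_^ d)) (ℕ.+-identityʳ d)
    (isPolynomial-resp-≗ (d + 0) (λ x → sym (*-identityʳ _)) (isPolynomial-^· d 0 (1# , λ _ → refl)))

  -- f x − f a = (x − a) h x, with both sides moved so that no subtraction occurs.
  factor-theorem : ∀ d {f} → IsPolynomial (suc d) f → ∀ a →
    ∃[ h ] (IsPolynomial d h × (∀ x → f x ⊕ a · h x ≡ f a ⊕ x · h x))
  factor-theorem zero {f} (c , g , (k , g≗k) , f≗) a = (λ _ → k) , (k , λ _ → refl) , λ x → begin
    f x ⊕ a · k        ≡⟨ cong (_⊕ a · k) (trans (f≗ x) (cong (λ z → c ⊕ x · z) (g≗k x))) ⟩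
    c ⊕ x · k ⊕ a · k  ≡⟨ solve 4 (λ c x a k → c :+ x :* k :+ a :* k := (c :+ a :* k) :+ x :* k) refl c x a k ⟩
    c ⊕ a · k ⊕ x · k  ≡⟨ cong (_⊕ x · k) (trans (f≗ a) (cong (λ z → c ⊕ a · z) (g≗k a))) ⟨
    f a ⊕ x · k        ∎
  factor-theorem (suc d) {f} (c , g , g-poly , f≗) a with factor-theorem d g-poly a
  ... | h , h-poly , g-factors = (λ x → g a ⊕ x · h x) , (g a , h , h-poly , λ _ → refl) , λ x → begin
    f x ⊕ a · (g a ⊕ x · h x)          ≡⟨ cong (_⊕ a · (g a ⊕ x · h x)) (f≗ x) ⟩
    c ⊕ x · g x ⊕ a · (g a ⊕ x · h x)  ≡⟨ solve 6 (λ c x gx a ga hx →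
                                            c :+ x :* gx :+ a :* (ga :+ x :* hx) := (c :+ a :* ga) :+ x :* (gx :+ a :* hx))
                                          refl c x (g x) a (g a) (h x) ⟩
    c ⊕ a · g a ⊕ x · (g x ⊕ a · h x)  ≡⟨ cong₂ (λ u v → u ⊕ x · v) (sym (f≗ a)) (g-factors x) ⟩
    f a ⊕ x · (g a ⊕ x · h x)          ∎

  roots≤degree : ∀ d {f x₀} → IsPolynomial d f → f x₀ ≢ 0# →
    ∀ {xs} → Unique xs → All (λ x → f x ≡ 0#) xs → length xs ≤ d
  roots≤degree d f-poly fx₀≢0 {[]} _ _ = z≤n
  roots≤degree zero (c , f≗c) fx₀≢0 {r ∷ _} _ (fr≡0 ∷ _) = contradiction (trans (f≗c _) (trans (sym (f≗c r)) fr≡0)) fx₀≢0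
  roots≤degree (suc d) {f} {x₀} f-poly fx₀≢0 {r ∷ rs} (r∉rs ∷ rs-unique) (fr≡0 ∷ frs≡0) with factor-theorem d f-poly r
  ... | h , h-poly , f-factors = s≤s (roots≤degree d h-poly hx₀≢0 rs-unique (hroots r∉rs frs≡0))
    where
    r·h≡x·h : ∀ {x} → f x ≡ 0# → r · h x ≡ x · h x
    r·h≡x·h {x} fx≡0 = begin
      r · h x        ≡⟨ +-identityˡ _ ⟨
      0# ⊕ r · h x   ≡⟨ cong (_⊕ r · h x) fx≡0 ⟨
      f x ⊕ r · h x  ≡⟨ f-factors x ⟩
      f r ⊕ x · h x  ≡⟨ cong (_⊕ x · h x) fr≡0 ⟩
      0# ⊕ x · h x   ≡⟨ +-identityˡ _ ⟩
      x · h x        ∎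
    hx₀≢0 : h x₀ ≢ 0#
    hx₀≢0 hx₀≡0 = fx₀≢0 (begin
      f x₀                ≡⟨ +-identityʳ _ ⟨
      f x₀ ⊕ 0#           ≡⟨ cong (f x₀ ⊕_) (trans (cong (r ·_) hx₀≡0) (zeroʳ r)) ⟨
      f x₀ ⊕ r · h x₀     ≡⟨ f-factors x₀ ⟩
      f r ⊕ x₀ · h x₀     ≡⟨ cong₂ _⊕_ fr≡0 (trans (cong (x₀ ·_) hx₀≡0) (zeroʳ x₀)) ⟩
      0# ⊕ 0#             ≡⟨ +-identityˡ 0# ⟩
      0#                  ∎)
    hroots : ∀ {ys} → All (r ≢_) ys → All (λ y → f y ≡ 0#) ys → All (λ y → h y ≡ 0#) ys
    hroots [] [] = []
    hroots {y ∷ _} (r≢y ∷ r≢ys) (fy≡0 ∷ fys≡0) = hy≡0 ∷ hroots r≢ys fys≡0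
      where
      hy≡0 : h y ≡ 0#
      hy≡0 with h y ≟ 0#
      ... | yes hy≡0 = hy≡0
      ... | no hy≢0 = contradiction (·-cancelˡ hy≢0 (trans (*-comm _ _) (trans (r·h≡x·h fy≡0) (*-comm _ _)))) r≢y

  ∃-^≢ : ∀ {g} → 1 ≤ g → ∀ c → ∃[ x₀ ] (x₀ ^ g ≢ c)
  ∃-^≢ {g} 1≤g c with c ≟ 1#
  ... | yes c≡1 = 0# , λ 0ᵍ≡c → 0≢1 (trans (sym (0^ 1≤g)) (trans 0ᵍ≡c c≡1))
  ... | no c≢1 = 1# , λ 1ᵍ≡c → c≢1 (trans (sym 1ᵍ≡c) (1^ g))

  roots-of-x^g≡c : ∀ {g} → 1 ≤ g → ∀ c {ys} → Unique ys → All (λ y → y ^ g ≡ c) ys → length ys ≤ g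
  roots-of-x^g≡c {g} 1≤g c ys-unique ys-roots with ∃-^≢ 1≤g c
  ... | x₀ , x₀ᵍ≢c = roots≤degree g (isPolynomial-const⊕ g (⊝ c) (isPolynomial-^ g))
    (λ fx₀≡0 → x₀ᵍ≢c (x-y≡0⇒x≡y (trans (+-comm _ _) fx₀≡0))) ys-unique
    (All.map (λ yᵍ≡c → trans (cong (⊝ c ⊕_) yᵍ≡c) (-‿inverseˡ c)) ys-roots)

  geometric : ℕ → ℕ → Carrier → Carrier
  geometric g zero x = 0#
  geometric g (suc t) x = 1# ⊕ x ^ g · geometric g t x

  isPolynomial-geometric : ∀ g t → IsPolynomial (g * t) (geometric g (suc t))
  isPolynomial-geometric g zero = subst (λ e → IsPolynomial e (geometric g 1)) (sym (ℕ.*-zeroʳ g))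
    (1# , λ x → trans (cong (1# ⊕_) (zeroʳ _)) (+-identityʳ 1#))
  isPolynomial-geometric g (suc t) = subst (λ e → IsPolynomial e (geometric g (suc (suc t)))) (sym (ℕ.*-suc g t))
    (isPolynomial-const⊕ (g + g * t) 1# (isPolynomial-^· g (g * t) (isPolynomial-geometric g t)))

  geometric-telescopes : ∀ g t x → x ^ g · geometric g t x ⊕ 1# ≡ geometric g t x ⊕ x ^ (g * t)
  geometric-telescopes g zero x = begin
    x ^ g · 0# ⊕ 1#    ≡⟨ cong (_⊕ 1#) (zeroʳ _) ⟩
    0# ⊕ 1#            ≡⟨ +-identityˡ 1# ⟩
    1#                 ≡⟨ cong (x ^_) (ℕ.*-zeroʳ g) ⟨
    x ^ (g * 0)        ≡⟨ +-identityˡ _ ⟨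
    0# ⊕ x ^ (g * 0)   ∎
  geometric-telescopes g (suc t) x = begin
    A · (1# ⊕ A · B) ⊕ 1#    ≡⟨ solve 2 (λ A B → A :* (con 1 :+ A :* B) :+ con 1 := A :* (A :* B :+ con 1) :+ con 1) refl A B ⟩
    A · (A · B ⊕ 1#) ⊕ 1#    ≡⟨ cong (λ z → A · z ⊕ 1#) (geometric-telescopes g t x) ⟩
    A · (B ⊕ C) ⊕ 1#         ≡⟨ solve 3 (λ A B C → A :* (B :+ C) :+ con 1 := (con 1 :+ A :* B) :+ A :* C) refl A B C ⟩
    1# ⊕ A · B ⊕ A · C       ≡⟨ cong (1# ⊕ A · B ⊕_) (trans (sym (^-+ x g (g * t))) (cong (x ^_) (sym (ℕ.*-suc g t)))) ⟩
    1# ⊕ A · B ⊕ x ^ (g * suc t) ∎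
    where
    A = x ^ g
    B = geometric g t x
    C = x ^ (g * t)

  module Π = Algebra.Properties.CommutativeMonoid.Sum (CommutativeRing.*-commutativeMonoid ring)

  Π-≢0 : ∀ {k} (f : Fin k → Carrier) → (∀ i → f i ≢ 0#) → Π.sum f ≢ 0#
  Π-≢0 {zero} f _ = 1≢0
  Π-≢0 {suc k} f f≢0 = ·-≢0 (f≢0 Fin.zero) (Π-≢0 (f ∘ Fin.suc) (f≢0 ∘ Fin.suc))

  Π-const : ∀ k x → Π.sum {k} (λ _ → x) ≡ x ^ k
  Π-const k x = trans (Π.sum-replicate k) (sym (^≡^ x k))

module FiniteFieldProperties {n : ℕ} (K : FiniteField (suc (suc n))) where
  open FiniteField K renaming (_+_ to infixl 6 _⊕_; _*_ to infixl 7 _·_; -_ to ⊝_)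
  open IsCommutativeRing isCommutativeRing using (*-assoc; *-comm; *-identityˡ; *-identityʳ; zeroˡ; zeroʳ; +-identityʳ)
  open FieldProperties K
  open Residues n
  open ≡-Reasoning

  private
    N : ℕ
    N = suc n

  nonzero : Fin N → Carrier
  nonzero j = element (Fin.punchIn (index 0#) j)

  nonzero-≢0 : ∀ j → nonzero j ≢ 0#
  nonzero-≢0 j nonzero≡0 = Fin.punchInᵢ≢i (index 0#) j (trans (sym (index-element _)) (cong index nonzero≡0))

  nonzero-injective : ∀ {i j} → nonzero i ≡ nonzero j → i ≡ j
  nonzero-injective {i} {j} eq = Fin.punchIn-injective (index 0#) i j
    (trans (sym (index-element _)) (trans (cong index eq) (index-element _)))

  nonzeros : List Carrier
  nonzeros = tabulate nonzero

  nonzeros-unique : Unique nonzeros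
  nonzeros-unique = Unique.tabulate⁺ nonzero-injective

  nonzeros-≢0 : All (_≢ 0#) nonzeros
  nonzeros-≢0 = All.tabulate⁺ nonzero-≢0

  scaling : ∀ {x} → x ≢ 0# → Carrier ↔ Carrier
  scaling {x} x≢0 with inverse x x≢0
  ... | y , xy≡1 = mk↔ₛ′ (x ·_) (y ·_) (cancels xy≡1) (cancels (trans (*-comm y x) xy≡1))
    where
    cancels : ∀ {u v} → u · v ≡ 1# → ∀ z → u · (v · z) ≡ z
    cancels {u} {v} uv≡1 z = trans (sym (*-assoc u v z)) (trans (cong (_· z) uv≡1) (*-identityˡ z))

  -- Multiplication by x permutes the nonzero elements, so their product P satisfies xᴺ · P = P.
  fermat : ∀ {x} → x ≢ 0# → x ^ N ≡ 1#
  fermat {x} x≢0 = ·-cancelˡ (Π-≢0 nonzero nonzero-≢0) (trans (*-comm _ _) (trans xᴺΠ≡Π (sym (*-identityʳ _))))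
    where
    π : Permutation (suc N) (suc N)
    π = ↔-trans (↔-sym card↔) (↔-trans (scaling x≢0) card↔)
    π′ : Permutation N N
    π′ = Perm.remove (index 0#) π
    π-fixes-0 : π ⟨$⟩ʳ index 0# ≡ index 0#
    π-fixes-0 = cong index (trans (cong (x ·_) (element-index 0#)) (zeroʳ x))
    x·nonzero : ∀ j → x · nonzero j ≡ nonzero (π′ ⟨$⟩ʳ j)
    x·nonzero j = begin
      x · nonzero j                                            ≡⟨ element-index _ ⟨
      element (π ⟨$⟩ʳ Fin.punchIn (index 0#) j)                ≡⟨ cong element (Perm.punchIn-permute π (index 0#) j) ⟩
      element (Fin.punchIn (π ⟨$⟩ʳ index 0#) (π′ ⟨$⟩ʳ j))      ≡⟨ cong (λ i → element (Fin.punchIn i (π′ ⟨$⟩ʳ j))) π-fixes-0 ⟩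
      nonzero (π′ ⟨$⟩ʳ j)                                      ∎
    xᴺΠ≡Π : x ^ N · Π.sum nonzero ≡ Π.sum nonzero
    xᴺΠ≡Π = begin
      x ^ N · Π.sum nonzero                   ≡⟨ cong (_· Π.sum nonzero) (Π-const N x) ⟨
      Π.sum {N} (λ _ → x) · Π.sum nonzero     ≡⟨ Π.∑-distrib-+ (λ _ → x) nonzero ⟨
      Π.sum (λ j → x · nonzero j)             ≡⟨ Π.sum-cong-≗ x·nonzero ⟩
      Π.sum (λ j → nonzero (π′ ⟨$⟩ʳ j))       ≡⟨ Π.sum-permute nonzero π′ ⟨
      Π.sum nonzero                           ∎

  ^≡^% : ∀ {x} a → x ≢ 0# → x ^ a ≡ x ^ (a % N)
  ^≡^% {x} a x≢0 = begin
    x ^ a                           ≡⟨ cong (x ^_) (m≡m%n+[m/n]*n a N) ⟩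
    x ^ (a % N + a / N * N)         ≡⟨ ^-+ x (a % N) (a / N * N) ⟩
    x ^ (a % N) · x ^ (a / N * N)   ≡⟨ cong (λ e → x ^ (a % N) · x ^ e) (ℕ.*-comm (a / N) N) ⟩
    x ^ (a % N) · x ^ (N * (a / N)) ≡⟨ cong (x ^ (a % N) ·_) (^-* x N (a / N)) ⟩
    x ^ (a % N) · (x ^ N) ^ (a / N) ≡⟨ cong (λ y → x ^ (a % N) · y ^ (a / N)) (fermat x≢0) ⟩
    x ^ (a % N) · 1# ^ (a / N)      ≡⟨ cong (x ^ (a % N) ·_) (1^ (a / N)) ⟩
    x ^ (a % N) · 1#                ≡⟨ *-identityʳ _ ⟩
    x ^ (a % N)                     ∎

  ^-cong-% : ∀ {a b} → 1 ≤ a → 1 ≤ b → a % N ≡ b % N → ∀ x → x ^ a ≡ x ^ b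
  ^-cong-% {a} {b} 1≤a 1≤b a≡b x with x ≟ 0#
  ... | yes refl = trans (0^ 1≤a) (sym (0^ 1≤b))
  ... | no x≢0 = trans (^≡^% a x≢0) (trans (cong (x ^_) a≡b) (sym (^≡^% b x≢0)))

  ^-cong-gcd : ∀ {a x y} → 1 ≤ a → x ^ a ≡ y ^ a → x ^ gcd a N ≡ y ^ gcd a N
  ^-cong-gcd {a} {x} {y} 1≤a xᵃ≡yᵃ with x ≟ 0# | y ≟ 0# | bézout-% a
  ... | yes x≡0 | _ | _ = cong (_^ gcd a N) (trans x≡0 (sym (^≡0⇒≡0 a (trans (sym xᵃ≡yᵃ) (trans (cong (_^ a) x≡0) (0^ 1≤a))))))
  ... | no _ | yes y≡0 | _ = cong (_^ gcd a N) (trans (^≡0⇒≡0 a (trans xᵃ≡yᵃ (trans (cong (_^ a) y≡0) (0^ 1≤a)))) (sym y≡0))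
  ... | no x≢0 | no y≢0 | u , ua≡gcd = trans (via-bézout x≢0) (trans (cong (_^ u) xᵃ≡yᵃ) (sym (via-bézout y≢0)))
    where
    via-bézout : ∀ {z} → z ≢ 0# → z ^ gcd a N ≡ (z ^ a) ^ u
    via-bézout {z} z≢0 = begin
      z ^ gcd a N          ≡⟨ ^≡^% (gcd a N) z≢0 ⟩
      z ^ (gcd a N % N)    ≡⟨ cong (z ^_) ua≡gcd ⟨
      z ^ (u * a % N)      ≡⟨ ^≡^% (u * a) z≢0 ⟨
      z ^ (u * a)          ≡⟨ cong (z ^_) (ℕ.*-comm u a) ⟩
      z ^ (a * u)          ≡⟨ ^-* z a u ⟩
      (z ^ a) ^ u          ∎

  -- With N = g (t + 1), every nonzero x with xᵍ ≠ 1 is a root of G = 1 + xᵍ + … + x^(g t),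
  -- since (xᵍ − 1) G(x) = xᴺ − 1 = 0; as G has degree g t, at least g of the N nonzero
  -- elements satisfy xᵍ = 1.
  ∃-roots-of-unity : ∀ {g} → g ∣ N → ∃[ ys ] (Unique ys × All (λ y → y ^ g ≡ 1#) ys × g ≤ length ys)
  ∃-roots-of-unity {zero} 0∣N = contradiction (0∣⇒≡0 0∣N) λ ()
  ∃-roots-of-unity {suc g′} (divides zero ())
  ∃-roots-of-unity {g@(suc g′)} (divides (suc t) N≡[1+t]g) =
    roots , Unique.filter⁺ isRoot? nonzeros-unique , All.all-filter isRoot? nonzeros , g≤#roots
    where
    isRoot? : ∀ y → Dec (y ^ g ≡ 1#)
    isRoot? y = y ^ g ≟ 1#
    roots = filter isRoot? nonzeros
    non-roots = filter (¬? ∘ isRoot?) nonzeros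
    N≡g+gt : N ≡ g + g * t
    N≡g+gt = trans N≡[1+t]g (trans (ℕ.*-comm (suc t) g) (ℕ.*-suc g t))
    G = geometric g (suc t)
    G[0]≢0 : G 0# ≢ 0#
    G[0]≢0 G[0]≡0 = 1≢0 (begin
      1#                        ≡⟨ +-identityʳ 1# ⟨
      1# ⊕ 0#                   ≡⟨ cong (1# ⊕_) (zeroˡ _) ⟨
      1# ⊕ 0# · geometric g t 0#  ≡⟨ cong (λ z → 1# ⊕ z · geometric g t 0#) (0^ {g} (s≤s z≤n)) ⟨
      G 0#                      ≡⟨ G[0]≡0 ⟩
      0#                        ∎)
    G-vanishes : ∀ {x} → x ≢ 0# → ¬ x ^ g ≡ 1# → G x ≡ 0#
    G-vanishes {x} x≢0 xᵍ≢1 with G x ≟ 0#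
    ... | yes Gx≡0 = Gx≡0
    ... | no Gx≢0 = contradiction (·-cancelˡ Gx≢0 (trans (*-comm _ _) (trans (+-cancelʳ 1# xᵍG+1≡G+1) (sym (*-identityʳ _))))) xᵍ≢1
      where
      xᵍG+1≡G+1 : x ^ g · G x ⊕ 1# ≡ G x ⊕ 1#
      xᵍG+1≡G+1 = trans (geometric-telescopes g (suc t) x)
        (cong (G x ⊕_) (trans (cong (x ^_) (trans (ℕ.*-suc g t) (sym N≡g+gt))) (fermat x≢0)))
    non-roots-vanish : All (λ x → G x ≡ 0#) non-roots
    non-roots-vanish = All.zipWith (λ (x≢0 , ¬root) → G-vanishes x≢0 ¬root)
      (All.filter⁺ (¬? ∘ isRoot?) nonzeros-≢0 , All.all-filter (¬? ∘ isRoot?) nonzeros)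
    #non-roots≤ : length non-roots ≤ g * t
    #non-roots≤ = roots≤degree (g * t) (isPolynomial-geometric g t) G[0]≢0
      (Unique.filter⁺ (¬? ∘ isRoot?) nonzeros-unique) non-roots-vanish
    g≤#roots : g ≤ length roots
    g≤#roots = ℕ.+-cancelʳ-≤ (g * t) g (length roots) (ℕ.≤-trans (ℕ.≤-reflexive #nonzeros) (ℕ.+-monoʳ-≤ (length roots) #non-roots≤))
      where
      #nonzeros : g + g * t ≡ length roots + length non-roots
      #nonzeros = trans (sym N≡g+gt) (trans (sym (length-tabulate nonzero)) (sym (length-filter-∁ isRoot? nonzeros)))

  ^≉^ : ∀ {a b} → 1 ≤ a → a < b → b ≤ N → ¬ (∀ x → x ^ a ≡ x ^ b)
  ^≉^ {a} {b} 1≤a a<b b≤N xᵃ≡xᵇ = ℕ.<⇒≱ d<N (subst (_≤ d) (length-tabulate nonzero)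
    (roots-of-x^g≡c (ℕ.m<n⇒0<n∸m a<b) 1# nonzeros-unique (All.map xᵈ≡1 nonzeros-≢0)))
    where
    d = b ∸ a
    d<N : d < N
    d<N = ℕ.<-≤-trans (ℕ.∸-monoʳ-< 1≤a (ℕ.<⇒≤ a<b)) b≤N
    xᵈ≡1 : ∀ {x} → x ≢ 0# → x ^ d ≡ 1#
    xᵈ≡1 {x} x≢0 = ·-cancelˡ (^-≢0 a x≢0) (begin
      x ^ a · x ^ d  ≡⟨ ^-+ x a d ⟨
      x ^ (a + d)    ≡⟨ cong (x ^_) (ℕ.m+[n∸m]≡n (ℕ.<⇒≤ a<b)) ⟩
      x ^ b          ≡⟨ xᵃ≡xᵇ x ⟨
      x ^ a          ≡⟨ *-identityʳ _ ⟨
      x ^ a · 1#     ∎)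

  ^-injective : ∀ {a b} → InRange (suc N) a → InRange (suc N) b → (∀ x → x ^ a ≡ x ^ b) → a ≡ b
  ^-injective {a} {b} (1≤a , a≤N) (1≤b , b≤N) xᵃ≡xᵇ with ℕ.<-cmp a b
  ... | tri< a<b _ _ = contradiction xᵃ≡xᵇ (^≉^ 1≤a a<b b≤N)
  ... | tri≈ _ a≡b _ = a≡b
  ... | tri> _ _ b<a = contradiction (sym ∘ xᵃ≡xᵇ) (^≉^ 1≤b b<a a≤N)

module MonomialDigraph {n : ℕ} (K : FiniteField (suc (suc n))) where
  open FiniteField K renaming (_+_ to infixl 6 _⊕_; _*_ to infixl 7 _·_; -_ to ⊝_)
  open IsCommutativeRing isCommutativeRing
    using (+-assoc; +-comm; +-identityˡ; +-identityʳ; -‿inverseʳ; *-comm; *-identityˡ; *-identityʳ; zeroʳ)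
  open FieldProperties K
  open FiniteFieldProperties K
  open Residues n

  private
    N : ℕ
    N = suc n

  ≅D-sym : ∀ {a b a′ b′} → (a , b) ≅D (a′ , b′) → (a′ , b′) ≅D (a , b)
  ≅D-sym {a} {b} {a′} {b′} (φ , φ-arcs) = ↔⇒⤖ (↔-sym φ↔) , λ u v → mk⇔
    (λ arc → Equivalence.from (φ-arcs (from u) (from v)) (subst₂ (Arc a′ b′) (sym (to-from u)) (sym (to-from v)) arc))
    (λ arc → subst₂ (Arc a′ b′) (to-from u) (to-from v) (Equivalence.to (φ-arcs (from u) (from v)) arc))
    where
    φ↔ = ⤖⇒↔ φ
    open Inverse φ↔ using (from) renaming (strictlyInverseˡ to to-from)

  powMap : ℕ → Vertex → Vertex
  powMap k (x₁ , x₂) = (x₁ ^ k , x₂)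

  ≅D-powMap : ∀ {k k′ a b a′ b′} → 1 ≤ k → 1 ≤ k′ → k * k′ % N ≡ 1 % N →
    1 ≤ a → 1 ≤ b → 1 ≤ a′ → 1 ≤ b′ → a % N ≡ k * a′ % N → b % N ≡ k * b′ % N → (a , b) ≅D (a′ , b′)
  ≅D-powMap {k} {k′} {a} {b} {a′} {b′} 1≤k 1≤k′ kk′≡1 1≤a 1≤b 1≤a′ 1≤b′ a≡ka′ b≡kb′ =
    ↔⇒⤖ (mk↔ₛ′ (powMap k) (powMap k′) (powMap-inverse 1≤k′ 1≤k (trans (cong (_% N) (ℕ.*-comm k′ k)) kk′≡1))
                                      (powMap-inverse 1≤k 1≤k′ kk′≡1)) ,
    λ { (x₁ , x₂) (y₁ , y₂) → mk⇔ (λ arc → trans arc (sym (rhs x₁ y₁))) (λ arc → trans arc (rhs x₁ y₁)) }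
    where
    ^-^ : ∀ {e e′ f} → 1 ≤ e → 1 ≤ e′ → 1 ≤ f → f % N ≡ e * e′ % N → ∀ x → (x ^ e) ^ e′ ≡ x ^ f
    ^-^ {e} {e′} 1≤e 1≤e′ 1≤f f≡ee′ x = trans (sym (^-* x e e′)) (^-cong-% (ℕ.*-mono-≤ 1≤e 1≤e′) 1≤f (sym f≡ee′) x)
    powMap-inverse : ∀ {e e′} → 1 ≤ e → 1 ≤ e′ → e * e′ % N ≡ 1 % N → ∀ v → powMap e′ (powMap e v) ≡ v
    powMap-inverse 1≤e 1≤e′ ee′≡1 (x₁ , x₂) = cong (_, x₂) (trans (^-^ 1≤e 1≤e′ (s≤s z≤n) (sym ee′≡1) x₁) (*-identityʳ x₁))
    rhs : ∀ x₁ y₁ → (x₁ ^ k) ^ a′ · (y₁ ^ k) ^ b′ ≡ x₁ ^ a · y₁ ^ b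
    rhs x₁ y₁ = cong₂ _·_ (^-^ 1≤k 1≤a′ 1≤a a≡ka′ x₁) (^-^ 1≤k 1≤b′ 1≤b b≡kb′ y₁)

  OutTwins : ℕ → ℕ → Vertex → Vertex → Set
  OutTwins a b u v = ∀ w → Arc a b u w ⇔ Arc a b v w

  outTwins⇐ : ∀ {a b x₁ y₁ x₂} → x₁ ^ a ≡ y₁ ^ a → OutTwins a b (x₁ , x₂) (y₁ , x₂)
  outTwins⇐ {b = b} xᵃ≡yᵃ (w₁ , w₂) =
    mk⇔ (λ arc → trans arc (cong (_· w₁ ^ b) xᵃ≡yᵃ)) (λ arc → trans arc (cong (_· w₁ ^ b) (sym xᵃ≡yᵃ)))

  outTwins⇒ : ∀ {a b x₁ x₂ y₁ y₂} → 1 ≤ b → OutTwins a b (x₁ , x₂) (y₁ , y₂) → x₁ ^ a ≡ y₁ ^ a × x₂ ≡ y₂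
  outTwins⇒ {a} {b} {x₁} {x₂} {y₁} {y₂} 1≤b twins = x₁ᵃ≡y₁ᵃ , sym y₂≡x₂
    where
    ·0ᵇ : ∀ z → z ^ a · 0# ^ b ≡ 0#
    ·0ᵇ z = trans (cong (z ^ a ·_) (0^ 1≤b)) (zeroʳ _)
    ·1ᵇ : ∀ z → z ^ a · 1# ^ b ≡ z ^ a
    ·1ᵇ z = trans (cong (z ^ a ·_) (1^ b)) (*-identityʳ _)
    x⊕[⊝x⊕z] : ∀ x z → x ⊕ (⊝ x ⊕ z) ≡ z
    x⊕[⊝x⊕z] x z = trans (sym (+-assoc x (⊝ x) z)) (trans (cong (_⊕ z) (-‿inverseʳ x)) (+-identityˡ z))
    y₂≡x₂ : y₂ ≡ x₂
    y₂≡x₂ = x-y≡0⇒x≡y (trans (Equivalence.to (twins (0# , ⊝ x₂)) (trans (-‿inverseʳ x₂) (sym (·0ᵇ x₁)))) (·0ᵇ y₁))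
    open ≡-Reasoning
    x₁ᵃ≡y₁ᵃ : x₁ ^ a ≡ y₁ ^ a
    x₁ᵃ≡y₁ᵃ = begin
      x₁ ^ a                      ≡⟨ x⊕[⊝x⊕z] x₂ (x₁ ^ a) ⟨
      x₂ ⊕ (⊝ x₂ ⊕ x₁ ^ a)        ≡⟨ cong (_⊕ (⊝ x₂ ⊕ x₁ ^ a)) y₂≡x₂ ⟨
      y₂ ⊕ (⊝ x₂ ⊕ x₁ ^ a)        ≡⟨ Equivalence.to (twins (1# , ⊝ x₂ ⊕ x₁ ^ a)) (trans (x⊕[⊝x⊕z] x₂ (x₁ ^ a)) (sym (·1ᵇ x₁))) ⟩
      y₁ ^ a · 1# ^ b             ≡⟨ ·1ᵇ y₁ ⟩
      y₁ ^ a                      ∎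

  ≅D-outTwins : ∀ {a b a′ b′} (φ : (a , b) ≅D (a′ , b′)) → let to = Bijection.to (proj₁ φ) in
    ∀ {u v} → OutTwins a b u v → OutTwins a′ b′ (to u) (to v)
  ≅D-outTwins {a} {b} {a′} {b′} (φ , φ-arcs) {u} {v} twins w′ = begin
    Arc a′ b′ (to u) w′              ≡⟨ cong (Arc a′ b′ (to u)) (to-from w′) ⟨
    Arc a′ b′ (to u) (to (from w′))  ≈⟨ φ-arcs u (from w′) ⟨
    Arc a b u (from w′)              ≈⟨ twins (from w′) ⟩
    Arc a b v (from w′)              ≈⟨ φ-arcs v (from w′) ⟩
    Arc a′ b′ (to v) (to (from w′))  ≡⟨ cong (Arc a′ b′ (to v)) (to-from w′) ⟩
    Arc a′ b′ (to v) w′              ∎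
    where
    open Inverse (⤖⇒↔ φ) using (to; from) renaming (strictlyInverseˡ to to-from)
    open SetoidReasoning (⇔-setoid 0ℓ)

  outTwin-class≤gcd : ∀ {a b} → 1 ≤ a → 1 ≤ b → ∀ p {vs} → Unique vs → All (OutTwins a b p) vs → length vs ≤ gcd a N
  outTwin-class≤gcd {a} {b} 1≤a 1≤b (p₁ , p₂) {vs} vs-unique vs-twins =
    subst (_≤ gcd a N) (length-map proj₁ vs)
      (roots-of-x^g≡c 1≤gcd (p₁ ^ gcd a N) (Unique-map⁺ twins-injective vs-twins vs-unique)
        (All.map⁺ (All.map (λ twins → sym (^-cong-gcd 1≤a (proj₁ (outTwins⇒ {a} {b} 1≤b twins)))) vs-twins)))
    where
    1≤gcd : 1 ≤ gcd a N
    1≤gcd = ℕ.n≢0⇒n>0 (gcd[m,n]≢0 a N (inj₂ λ ()))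
    twins-injective : ∀ {v w} → OutTwins a b (p₁ , p₂) v → OutTwins a b (p₁ , p₂) w → proj₁ v ≡ proj₁ w → v ≡ w
    twins-injective {v₁ , v₂} {w₁ , w₂} v-twins w-twins v₁≡w₁ =
      cong₂ _,_ v₁≡w₁ (trans (sym (proj₂ (outTwins⇒ {a} {b} 1≤b v-twins))) (proj₂ (outTwins⇒ {a} {b} 1≤b w-twins)))

  ≅D-gcd≤ : ∀ {a b a′ b′} → (a , b) ≅D (a′ , b′) → 1 ≤ a′ → 1 ≤ b′ → gcd a N ≤ gcd a′ N
  ≅D-gcd≤ {a} {b} {a′} {b′} φ 1≤a′ 1≤b′ with ∃-roots-of-unity (gcd[m,n]∣n a N)
  ... | ys , ys-unique , ys-roots , g≤#ys = ℕ.≤-trans g≤#ys (subst (_≤ gcd a′ N) (length-map image ys)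
    (outTwin-class≤gcd 1≤a′ 1≤b′ (to (1# , 0#)) (Unique.map⁺ image-injective ys-unique) (All.map⁺ (All.map image-twins ys-roots))))
    where
    to = Bijection.to (proj₁ φ)
    image : Carrier → Vertex
    image y = to (y , 0#)
    image-injective : ∀ {y y′} → image y ≡ image y′ → y ≡ y′
    image-injective = cong proj₁ ∘ Bijection.injective (proj₁ φ)
    image-twins : ∀ {y} → y ^ gcd a N ≡ 1# → OutTwins a′ b′ (to (1# , 0#)) (image y)
    image-twins yᵍ≡1 = ≅D-outTwins {a} {b} {a′} {b′} φ (outTwins⇐ {a} {b} (trans (1^ a) (sym (^-∣ (gcd[m,n]∣m a N) yᵍ≡1))))

  ≅D-gcd : ∀ {a b a′ b′} → (a , b) ≅D (a′ , b′) → 1 ≤ a → 1 ≤ b → 1 ≤ a′ → 1 ≤ b′ → gcd a N ≡ gcd a′ N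
  ≅D-gcd {a} {b} {a′} {b′} φ 1≤a 1≤b 1≤a′ 1≤b′ =
    ℕ.≤-antisym (≅D-gcd≤ {a} {b} {a′} {b′} φ 1≤a′ 1≤b′) (≅D-gcd≤ {a′} {b′} {a} {b} (≅D-sym {a} {b} {a′} {b′} φ) 1≤a 1≤b)

  ArcSymmetric : ℕ → ℕ → Set
  ArcSymmetric a b = ∀ u v → Arc a b u v → Arc a b v u

  arcSymmetric-diagonal : ∀ a → ArcSymmetric a a
  arcSymmetric-diagonal a (x₁ , x₂) (y₁ , y₂) arc = trans (+-comm y₂ x₂) (trans arc (*-comm _ _))

  ≅D-arcSymmetric : ∀ {a b a′ b′} → (a , b) ≅D (a′ , b′) → ArcSymmetric a b → ArcSymmetric a′ b′
  ≅D-arcSymmetric {a} {b} {a′} {b′} φ symmetric u v arc with ≅D-sym {a} {b} {a′} {b′} φ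
  ... | ψ , ψ-arcs = Equivalence.from (ψ-arcs v u) (symmetric _ _ (Equivalence.to (ψ-arcs u v) arc))

  arcSymmetric⇒^≗^ : ∀ {a b} → ArcSymmetric a b → ∀ x → x ^ a ≡ x ^ b
  arcSymmetric⇒^≗^ {a} {b} symmetric x = begin
    x ^ a              ≡⟨ +-identityʳ _ ⟨
    x ^ a ⊕ 0#         ≡⟨ symmetric (x , 0#) (1# , x ^ a) (trans (+-identityˡ _) (sym (trans (cong (x ^ a ·_) (1^ b)) (*-identityʳ _)))) ⟩
    1# ^ a · x ^ b     ≡⟨ cong (_· x ^ b) (1^ a) ⟩
    1# · x ^ b         ≡⟨ *-identityˡ _ ⟩
    x ^ b              ∎
    where open ≡-Reasoning

  private
    q : ℕ
    q = suc N
    1≤* : ∀ {a b} → 1 ≤ a → 1 ≤ b → 1 ≤ a * b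
    1≤* = ℕ.*-mono-≤
    1≤1 : 1 ≤ 1
    1≤1 = s≤s z≤n
    ≡k*1 : ∀ k → k % N ≡ k * 1 % N
    ≡k*1 k = cong (_% N) (sym (ℕ.*-identityʳ k))

  ≅D-unit-normal-form : ∀ m b → InRange q m → InRange q b → gcd m N ≡ 1 →
    ∃[ b′ ] (InRange q b′ × (m * b′ ≡ b [mod N ]) × ((m , b) ≅D (1 , b′)))
  ≅D-unit-normal-form m b (1≤m , _) (1≤b , _) m⊥N with ∃-inverse m m⊥N
  ... | k′ , 1≤k′ , mk′≡1 with ∃-positive-representative (k′ * b)
  ... | b′ , b′-range@(1≤b′ , _) , b′≡k′b =
    b′ , b′-range , %≡⇒≡[mod] mb′≡b , ≅D-powMap 1≤m 1≤k′ mk′≡1 1≤m 1≤b 1≤1 1≤b′ (≡k*1 m) (sym mb′≡b)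
    where
    open ≡-Reasoning
    rearrange : ∀ m k b → m * (k * b) ≡ b * (m * k)
    rearrange = solve-∀
    mb′≡b : m * b′ % N ≡ b % N
    mb′≡b = begin
      m * b′ % N          ≡⟨ %-cong-*ˡ m b′≡k′b ⟩
      m * (k′ * b) % N    ≡⟨ cong (_% N) (rearrange m k′ b) ⟩
      b * (m * k′) % N    ≡⟨ %-cong-*ˡ b mk′≡1 ⟩
      b * 1 % N           ≡⟨ ≡k*1 b ⟨
      b % N               ∎

  ≅D-inverse-exponents : ∀ m b → InRange q m → InRange q b → (m * b ≡ 1 [mod N ]) →
    ((m , 1) ≅D (1 , b)) × ((m , b) ≅D (1 , b * b)) × ((1 , b * b) ≅D (m * m , 1))
  ≅D-inverse-exponents m b (1≤m , _) (1≤b , _) mb≡1[mod] =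
    ≅D-powMap 1≤m 1≤b mb≡1 1≤m 1≤1 1≤1 1≤b (≡k*1 m) (sym mb≡1) ,
    ≅D-powMap 1≤m 1≤b mb≡1 1≤m 1≤b 1≤1 (1≤* 1≤b 1≤b) (≡k*1 m) (sym m[bb]≡b) ,
    ≅D-powMap (1≤* 1≤b 1≤b) (1≤* 1≤m 1≤m) bbmm≡1 1≤1 (1≤* 1≤b 1≤b) (1≤* 1≤m 1≤m) 1≤1 (sym bbmm≡1) (≡k*1 (b * b))
    where
    open ≡-Reasoning
    mb≡1 : m * b % N ≡ 1 % N
    mb≡1 = ≡[mod]⇒%≡ mb≡1[mod]
    m[bb]≡b : m * (b * b) % N ≡ b % N
    m[bb]≡b = begin
      m * (b * b) % N    ≡⟨ cong (_% N) (rearrange m b) ⟩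
      b * (m * b) % N    ≡⟨ %-cong-*ˡ b mb≡1 ⟩
      b * 1 % N          ≡⟨ ≡k*1 b ⟨
      b % N              ∎
      where
      rearrange : ∀ m b → m * (b * b) ≡ b * (m * b)
      rearrange = solve-∀
    bbmm≡1 : b * b * (m * m) % N ≡ 1 % N
    bbmm≡1 = begin
      b * b * (m * m) % N      ≡⟨ cong (_% N) (rearrange m b) ⟩
      m * b * (m * b) % N      ≡⟨ %-cong-*ˡ (m * b) mb≡1 ⟩
      m * b * 1 % N            ≡⟨ ≡k*1 (m * b) ⟨
      m * b % N                ≡⟨ mb≡1 ⟩
      1 % N                    ∎
      where
      rearrange : ∀ m b → b * b * (m * m) ≡ m * b * (m * b)
      rearrange = solve-∀

  ≅D-swap : ∀ m b → InRange q m → InRange q b → (m + b ≡ 0 [mod N ]) → ((m , b) ≅D (b , m))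
  ≅D-swap m b (1≤m , _) (1≤b , _) m+b≡0 =
    ≅D-powMap 1≤minus-one 1≤minus-one minus-one² 1≤m 1≤b 1≤b 1≤m
      (%≡0⇒≡minus-one* m b (≡[mod]⇒%≡ m+b≡0)) (%≡0⇒≡minus-one* b m (≡[mod]⇒%≡ (subst (_≡ 0 [mod N ]) (ℕ.+-comm m b) m+b≡0)))
    where
    1≤minus-one : 1 ≤ minus-one
    1≤minus-one = s≤s z≤n

  ≅D-diagonal-rigid : ∀ m₁ n₁ m₂ n₂ → InRange q m₁ → InRange q n₁ → InRange q m₂ → InRange q n₂ →
    ((m₁ , n₁) ≅D (m₂ , n₂)) → m₁ ≡ n₁ → (m₂ ≡ n₂) × (gcd m₁ N ≡ gcd m₂ N)
  ≅D-diagonal-rigid m₁ .m₁ m₂ n₂ (1≤m₁ , _) _ m₂-range n₂-range φ refl =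
    ^-injective m₂-range n₂-range (arcSymmetric⇒^≗^ {m₂} {n₂} (≅D-arcSymmetric {m₁} {m₁} {m₂} {n₂} φ (arcSymmetric-diagonal m₁))) ,
    ≅D-gcd {m₁} {m₁} {m₂} {n₂} φ 1≤m₁ 1≤m₁ (proj₁ m₂-range) (proj₁ n₂-range)

  ≅D-diagonal-gcd : ∀ m b → InRange q m → InRange q b → gcd m N ≡ gcd b N → ((m , m) ≅D (b , b))
  ≅D-diagonal-gcd m b (1≤m , _) (1≤b , _) gcd≡ =
    let k , 1≤k , k⊥N , m≡kb = ∃-unit-multiple m b gcd≡
        k′ , 1≤k′ , kk′≡1 = ∃-inverse k k⊥N
    in ≅D-powMap 1≤k 1≤k′ kk′≡1 1≤m 1≤m 1≤b 1≤b m≡kb m≡kb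

finiteField-size≥2 : ∀ {q} → FiniteField q → 2 ≤ q
finiteField-size≥2 {zero} K = contradiction (Bijection.to (FiniteField.card K) (FiniteField.0# K)) λ ()
finiteField-size≥2 {suc zero} K = contradiction (Bijection.injective card (fin1-unique _ _)) 0≢1
  where
  open FiniteField K
  fin1-unique : ∀ (i j : Fin 1) → i ≡ j
  fin1-unique Fin.zero Fin.zero = refl
finiteField-size≥2 {suc (suc q)} K = s≤s (s≤s z≤n)

corollary6 : ∀ {q : ℕ} (K : FiniteField q) → let open FiniteField K using (_≅D_) in
    (∀ m n → InRange q m → InRange q n → gcd m (q ∸ 1) ≡ 1 →
      ∃[ n′ ] (InRange q n′ × (m * n′ ≡ n [mod q ∸ 1 ]) × ((m , n) ≅D (1 , n′))))
    × (∀ m n → InRange q m → InRange q n → (m * n ≡ 1 [mod q ∸ 1 ]) →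
      ((m , 1) ≅D (1 , n)) × ((m , n) ≅D (1 , n * n)) × ((1 , n * n) ≅D (m * m , 1)))
    × (∀ m n → InRange q m → InRange q n → (m + n ≡ 0 [mod q ∸ 1 ]) →
      ((m , n) ≅D (n , m)))
    × (∀ m₁ n₁ m₂ n₂ → InRange q m₁ → InRange q n₁ → InRange q m₂ → InRange q n₂ →
      ((m₁ , n₁) ≅D (m₂ , n₂)) → m₁ ≡ n₁ →
      (m₂ ≡ n₂) × (gcd m₁ (q ∸ 1) ≡ gcd m₂ (q ∸ 1)))
    × (∀ m n → InRange q m → InRange q n → gcd m (q ∸ 1) ≡ gcd n (q ∸ 1) →
      ((m , m) ≅D (n , n)))
corollary6 {zero} K = contradiction (finiteField-size≥2 K) λ ()
corollary6 {suc zero} K = contradiction (finiteField-size≥2 K) λ { (s≤s ()) }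
corollary6 {suc (suc n)} K =
  ≅D-unit-normal-form , ≅D-inverse-exponents , ≅D-swap , ≅D-diagonal-rigid , ≅D-diagonal-gcd
  where open MonomialDigraph K
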